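{- Consider the fragment of $\mathbf{ACT}_\omega$ in the language of $\backslash$, $/$, $\wedge$, $\top$ and $^*$, where $^*$ may occur only in subformulae of the form $A^*\backslash B$ and $B/A^*$. This fragment is strongly complete with respect to L-models: for every set $\mathcal H$ of sequents and sequent $\Pi\to C$ in this language, if $\Pi\to C$ is true in every L-model in which all sequents of $\mathcal H$ are true, then $\mathcal H\vdash\Pi\to C$ in this fragment.
   Context: Sequents $A_1,\dots,A_n\to B$, $n\ge0$. Rules of the fragment (those of $\mathbf{ACT}_\omega$ for these operations plus identity and Cut): $A\to A$; $\Pi\to\top$; from $\Pi\to A$ and $\Gamma,B,\Delta\to C$ infer $\Gamma,\Pi,A\backslash B,\Delta\to C$ and $\Gamma,B/A,\Pi,\Delta\to C$; from $A,\Pi\to B$ infer $\Pi\to A\backslash B$; from $\Pi,A\to B$ infer $\Pi\to B/A$; from $\Gamma,A,\Delta\to C$ (or $\Gamma,B,\Delta\to C$) infer $\Gamma,A\wedge B,\Delta\to C$; from $\Pi\to A$, $\Pi\to B$ infer $\Pi\to A\wedge B$; Cut: from $\Pi\to A$ and $\Gamma,A,\Delta\to C$ infer $\Gamma,\Pi,\Delta\to C$; from $\Gamma,A^n,\Delta\to C$ for all $n\ge0$ infer $\Gamma,A^*,\Delta\to C$; for $n\ge0$ from $\Pi_1\to A,\dots,\Pi_n\to A$ infer $\Pi_1,\dots,\Pi_n\to A^*$. Derivations may be infinite but well-founded; $\mathcal H$ serves as extra axioms. An L-model: an alphabet $\Sigma$ and interpretation $\alpha$ of variables as languages $\subseteq\Sigma^*$,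 extended by $\alpha(A\backslash B)=\{u\in\Sigma^*\mid\forall v\in\alpha(A)\;vu\in\alpha(B)\}$, $\alpha(B/A)=\{u\mid\forall v\in\alpha(A)\;uv\in\alpha(B)\}$, $\alpha(A\wedge B)=\alpha(A)\cap\alpha(B)$, $\alpha(\top)=\Sigma^*$, $\alpha(A^*)=\bigcup_{n\ge0}\alpha(A)^n$. $A_1,\dots,A_n\to B$ is true if $\alpha(A_1)\cdots\alpha(A_n)\subseteq\alpha(B)$ (concatenation; for $n=0$, if $\varepsilon\in\alpha(B)$). -}

module Defs where

open import Data.Nat using (ℕ; zero; suc)
open import Data.List using (List; []; _∷_; _++_; replicate; concat)
open import Data.List.Relation.Unary.All using (All)
open import Data.Product using (Σ; ∃; _×_; _,_)
open import Data.Unit using (⊤)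
open import Relation.Binary.PropositionalEquality using (_≡_)

infixr 30 _⧹_
infixl 30 _⧸_
infixl 35 _∧_
infix 40 _⋆

data Fm : Set where
  var : ℕ → Fm
  _⧹_ : Fm → Fm → Fm
  _⧸_ : Fm → Fm → Fm
  _∧_ : Fm → Fm → Fm
  ⊤ᶠ  : Fm
  _⋆  : Fm → Fm

infix 10 _⇒_
record Seq : Set where
  constructor _⇒_
  field
    ant : List Fm
    succ : Fm
open Seq public

data Good : Fm → Set where
  g-var  : ∀ p → Good (var p)
  g-⊤    : Good ⊤ᶠ
  g-∧    : ∀ {A B} → Good A → Good B → Good (A ∧ B)
  g-⧹    : ∀ {A B} → Good A → Good B → Good (A ⧹ B)
  g-⧸    : ∀ {A B} → Good A → Good B → Good (B ⧸ A)
  g-⋆⧹   : ∀ {A B} → Good A → Good B → Good (A ⋆ ⧹ B)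
  g-⧸⋆   : ∀ {A B} → Good A → Good B → Good (B ⧸ A ⋆)

GoodSeq : Seq → Set
GoodSeq (Π ⇒ C) = All Good Π × Good C

-- The inductive type gives exactly the well-founded (possibly infinite,
-- via the ω-rule) derivations.
infix 5 _⊢_
data _⊢_ (ℋ : Seq → Set) : Seq → Set where
  hyp   : ∀ {s} → ℋ s → ℋ ⊢ s
  ax    : ∀ {A} → ℋ ⊢ (A ∷ []) ⇒ A
  ⊤R    : ∀ {Π} → ℋ ⊢ Π ⇒ ⊤ᶠ
  ⧹L    : ∀ {Π Γ Δ A B C} → ℋ ⊢ Π ⇒ A → ℋ ⊢ (Γ ++ B ∷ Δ) ⇒ C →
          ℋ ⊢ (Γ ++ Π ++ (A ⧹ B) ∷ Δ) ⇒ C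
  ⧸L    : ∀ {Π Γ Δ A B C} → ℋ ⊢ Π ⇒ A → ℋ ⊢ (Γ ++ B ∷ Δ) ⇒ C →
          ℋ ⊢ (Γ ++ (B ⧸ A) ∷ Π ++ Δ) ⇒ C
  ⧹R    : ∀ {Π A B} → ℋ ⊢ (A ∷ Π) ⇒ B → ℋ ⊢ Π ⇒ (A ⧹ B)
  ⧸R    : ∀ {Π A B} → ℋ ⊢ (Π ++ A ∷ []) ⇒ B → ℋ ⊢ Π ⇒ (B ⧸ A)
  ∧L₁   : ∀ {Γ Δ A B C} → ℋ ⊢ (Γ ++ A ∷ Δ) ⇒ C → ℋ ⊢ (Γ ++ (A ∧ B) ∷ Δ) ⇒ C
  ∧L₂   : ∀ {Γ Δ A B C} → ℋ ⊢ (Γ ++ B ∷ Δ) ⇒ C → ℋ ⊢ (Γ ++ (A ∧ B) ∷ Δ) ⇒ C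
  ∧R    : ∀ {Π A B} → ℋ ⊢ Π ⇒ A → ℋ ⊢ Π ⇒ B → ℋ ⊢ Π ⇒ (A ∧ B)
  cut   : ∀ {Π Γ Δ A C} → ℋ ⊢ Π ⇒ A → ℋ ⊢ (Γ ++ A ∷ Δ) ⇒ C → ℋ ⊢ (Γ ++ Π ++ Δ) ⇒ C
  ⋆Lω   : ∀ {Γ Δ A C} → ((n : ℕ) → ℋ ⊢ (Γ ++ replicate n A ++ Δ) ⇒ C) →
          ℋ ⊢ (Γ ++ (A ⋆) ∷ Δ) ⇒ C
  ⋆R    : ∀ {A} (Πs : List (List Fm)) → All (λ Π → ℋ ⊢ Π ⇒ A) Πs →
          ℋ ⊢ concat Πs ⇒ (A ⋆)

record LModel : Set₁ where
  field
    Alph : Set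
    α    : ℕ → List Alph → Set

module _ (M : LModel) where
  open LModel M

  Lang : Set₁
  Lang = List Alph → Set

  pow : Lang → ℕ → Lang
  pow L zero    u = u ≡ []
  pow L (suc n) u = ∃ λ v → ∃ λ w → u ≡ v ++ w × L v × pow L n w

  ⟦_⟧ : Fm → Lang
  ⟦ var p ⟧ u = α p u
  ⟦ A ⧹ B ⟧ u = ∀ v → ⟦ A ⟧ v → ⟦ B ⟧ (v ++ u)
  ⟦ B ⧸ A ⟧ u = ∀ v → ⟦ A ⟧ v → ⟦ B ⟧ (u ++ v)
  ⟦ A ∧ B ⟧ u = ⟦ A ⟧ u × ⟦ B ⟧ u
  ⟦ ⊤ᶠ ⟧    u = ⊤
  ⟦ A ⋆ ⟧   u = Σ ℕ λ n → pow ⟦ A ⟧ n u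

  ⟦_⟧ₗ : List Fm → Lang
  ⟦ [] ⟧ₗ    u = u ≡ []
  ⟦ A ∷ Γ ⟧ₗ u = ∃ λ v → ∃ λ w → u ≡ v ++ w × ⟦ A ⟧ v × ⟦ Γ ⟧ₗ w

  TrueIn : Seq → Set
  TrueIn (Π ⇒ B) = ∀ u → ⟦ Π ⟧ₗ u → ⟦ B ⟧ u

{-# OPTIONS --safe #-}
-- Canonical model: the letters are formulas and a variable p denotes the set of
-- antecedents Π with ℋ ⊢ Π ⇒ p.  By mutual induction on a formula A of the
-- restricted language, u ∈ ⟦ A ⟧ exactly when ℋ ⊢ u ⇒ A.  Kleene star is the
-- obstacle, since ⟦ A ⋆ ⟧ need not contain every Π with ℋ ⊢ Π ⇒ A ⋆; but in
-- A ⋆ ⧹ B and B ⧸ A ⋆ the star stands in negative position, where only the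
-- inclusion ⟦ A ⋆ ⟧ ⊆ {Π | ℋ ⊢ Π ⇒ A ⋆} (rule ⋆R) and the instances A ⁿ
-- (rule ⋆Lω) are needed.  The canonical model then validates ℋ and refutes
-- every good sequent that ℋ does not derive.
module Submission where

open import Defs
open import Data.Nat using (zero; suc)
open import Data.List using (List; []; _∷_; _++_; replicate; concat)
open import Data.List.Properties using (++-identityʳ; ++-assoc)
open import Data.List.Relation.Unary.All as All using (All; []; _∷_)
open import Data.Product using (Σ; _×_; _,_)
open import Data.Unit using (tt)
open import Relation.Binary.PropositionalEquality using (_≡_; refl; sym; cong; subst)

module _ {ℋ : Seq → Set} where

  subst-ant : ∀ {Π Π′ C} → Π ≡ Π′ → ℋ ⊢ Π ⇒ C → ℋ ⊢ Π′ ⇒ C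
  subst-ant {C = C} = subst (λ Π → ℋ ⊢ Π ⇒ C)

  ⧹-elim : ∀ {Γ Π A B} → ℋ ⊢ Γ ⇒ A ⧹ B → ℋ ⊢ Π ⇒ A → ℋ ⊢ (Π ++ Γ) ⇒ B
  ⧹-elim {Γ} {Π} dΓ dΠ =
    subst-ant (cong (Π ++_) (++-identityʳ Γ))
      (cut {Γ = Π} {Δ = []} dΓ (⧹L {Γ = []} {Δ = []} dΠ ax))

  ⧸-elim : ∀ {Γ Π A B} → ℋ ⊢ Γ ⇒ B ⧸ A → ℋ ⊢ Π ⇒ A → ℋ ⊢ (Γ ++ Π) ⇒ B
  ⧸-elim {Γ} {Π} dΓ dΠ =
    subst-ant (cong (Γ ++_) (++-identityʳ Π))
      (cut {Γ = []} {Δ = Π ++ []} dΓ (⧸L {Γ = []} {Δ = []} dΠ ax))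

  ∧-elim₁ : ∀ {Π A B} → ℋ ⊢ Π ⇒ A ∧ B → ℋ ⊢ Π ⇒ A
  ∧-elim₁ {Π} d = subst-ant (++-identityʳ Π) (cut {Γ = []} {Δ = []} d (∧L₁ {Γ = []} {Δ = []} ax))

  ∧-elim₂ : ∀ {Π A B} → ℋ ⊢ Π ⇒ A ∧ B → ℋ ⊢ Π ⇒ B
  ∧-elim₂ {Π} d = subst-ant (++-identityʳ Π) (cut {Γ = []} {Δ = []} d (∧L₂ {Γ = []} {Δ = []} ax))

module _ (M : LModel) where
  open LModel M

  pow-replicate : ∀ {L : Lang M} {x} → L (x ∷ []) → ∀ n → pow M L n (replicate n x)
  pow-replicate Lx zero    = refl
  pow-replicate Lx (suc n) = _ , _ , refl , Lx , pow-replicate Lx n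

  pow⇒concat : ∀ {L : Lang M} n {u} → pow M L n u →
               Σ (List (List Alph)) λ us → concat us ≡ u × All L us
  pow⇒concat zero    refl = [] , refl , []
  pow⇒concat (suc n) (v , w , refl , Lv , Lⁿw) with pow⇒concat n Lⁿw
  ... | us , refl , Lus = v ∷ us , refl , Lv ∷ Lus

module Canonical (ℋ : Seq → Set) where

  canonical : LModel
  canonical = record { Alph = Fm ; α = λ p Π → ℋ ⊢ Π ⇒ var p }

  ⟦_⟧ᶜ : Fm → List Fm → Set
  ⟦_⟧ᶜ = ⟦ canonical ⟧

  ⋆R-⟦⟧ : ∀ {A} → (∀ {u} → ⟦ A ⟧ᶜ u → ℋ ⊢ u ⇒ A) → ∀ {u} → ⟦ A ⋆ ⟧ᶜ u → ℋ ⊢ u ⇒ A ⋆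
  ⋆R-⟦⟧ reifyA (n , Aⁿu) with pow⇒concat canonical n Aⁿu
  ... | us , refl , Aus = ⋆R us (All.map reifyA Aus)

  mutual
    reify : ∀ {A u} → Good A → ⟦ A ⟧ᶜ u → ℋ ⊢ u ⇒ A
    reify (g-var p) x     = x
    reify g-⊤ _           = ⊤R
    reify (g-∧ a b) (x , y) = ∧R (reify a x) (reify b y)
    reify (g-⧹ a b) x     = ⧹R (reify b (x _ (reflect-ax a)))
    reify (g-⧸ a b) x     = ⧸R (reify b (x _ (reflect-ax a)))
    reify {A ⋆ ⧹ B} {u} (g-⋆⧹ a b) x =
      ⧹R (⋆Lω {Γ = []} {Δ = u} λ n →
        reify b (x (replicate n A) (n , pow-replicate canonical (reflect-ax a) n)))
    reify {B ⧸ A ⋆} {u} (g-⧸⋆ a b) x =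
      ⧸R (⋆Lω {Γ = u} {Δ = []} λ n →
        subst-ant (sym (cong (u ++_) (++-identityʳ (replicate n A))))
          (reify b (x (replicate n A) (n , pow-replicate canonical (reflect-ax a) n))))

    reflect : ∀ {A u} → Good A → ℋ ⊢ u ⇒ A → ⟦ A ⟧ᶜ u
    reflect (g-var p) d  = d
    reflect g-⊤ _        = tt
    reflect (g-∧ a b) d  = reflect a (∧-elim₁ d) , reflect b (∧-elim₂ d)
    reflect (g-⧹ a b) d  = λ _ x → reflect b (⧹-elim d (reify a x))
    reflect (g-⧸ a b) d  = λ _ x → reflect b (⧸-elim d (reify a x))
    reflect (g-⋆⧹ a b) d = λ _ x → reflect b (⧹-elim d (⋆R-⟦⟧ (reify a) x))
    reflect (g-⧸⋆ a b) d = λ _ x → reflect b (⧸-elim d (⋆R-⟦⟧ (reify a) x))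

    reflect-ax : ∀ {A} → Good A → ⟦ A ⟧ᶜ (A ∷ [])
    reflect-ax a = reflect a ax

  reflect-ctx : ∀ {Π} → All Good Π → ⟦ canonical ⟧ₗ Π Π
  reflect-ctx []       = refl
  reflect-ctx (a ∷ as) = _ , _ , refl , reflect-ax a , reflect-ctx as

  cut-ctx : ∀ {Π C} Γ {u} → All Good Π → ℋ ⊢ (Γ ++ Π) ⇒ C → ⟦ canonical ⟧ₗ Π u → ℋ ⊢ (Γ ++ u) ⇒ C
  cut-ctx Γ [] d refl = d
  cut-ctx {A ∷ Π} Γ (a ∷ as) d (v , w , refl , x , y) =
    subst-ant (++-assoc Γ v w)
      (cut-ctx (Γ ++ v) as (subst-ant (sym (++-assoc Γ v Π)) (cut {Γ = Γ} (reify a x) d)) y)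

  canonical-sound : ∀ {s} → GoodSeq s → ℋ ⊢ s → TrueIn canonical s
  canonical-sound {Π ⇒ C} (as , c) d u x = reflect c (cut-ctx [] as d x)

  canonical-complete : ∀ {s} → GoodSeq s → TrueIn canonical s → ℋ ⊢ s
  canonical-complete {Π ⇒ C} (as , c) valid = reify c (valid Π (reflect-ctx as))

corollary2 : (ℋ : Seq → Set) → (∀ s → ℋ s → GoodSeq s) →
    (s : Seq) → GoodSeq s →
    ((M : LModel) → (∀ h → ℋ h → TrueIn M h) → TrueIn M s) →
    ℋ ⊢ s
corollary2 ℋ ℋ-good s s-good valid =
  canonical-complete s-good (valid canonical λ h h∈ℋ → canonical-sound (ℋ-good h h∈ℋ) (hyp h∈ℋ))
  where open Canonical ℋ
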